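{- For every $n\ge 1$, $$T_n(x,s,q)=\sum_{k=0}^{\lfloor n/2\rfloor}q^{k^2}\frac{(1+q)\cdots(1+q^{n-1})}{(1+q)\cdots(1+q^k)\cdot(1+q^{n-k})\cdots(1+q^{n-1})}\frac{[n]}{[n-k]}\begin{bmatrix} n-k\\ k\end{bmatrix}s^kx^{n-2k}$$ $$=\sum_{k=0}^{\lfloor (n-1)/2\rfloor}q^{k^2}(1+q^{k+1})\cdots(1+q^{n-k-1})\frac{[n]}{[n-k]}\begin{bmatrix} n-k\\ k\end{bmatrix}s^kx^{n-2k}+[n\equiv 0 \pmod 2]\,q^{n^2/4}s^{n/2}.$$
   Context: Let $q$ be a real number with $q\neq -1$. Let $[m]=1+q+\dots+q^{m-1}$, $[m]!=[1]\cdots[m]$, $\begin{bmatrix} m\\ j\end{bmatrix}=\frac{[m]!}{[j]![m-j]!}$ for $0\le j\le m$. Products of the form $(1+q^a)\cdots(1+q^b)$ mean $\prod_{i=a}^b(1+q^i)$ and equal $1$ if $b<a$. $[P]$ is $1$ if $P$ holds and $0$ otherwise. $T_0(x,s,q)=1$, $T_1(x,s,q)=x$, $T_n(x,s,q)=(1+q^{n-1})xT_{n-1}(x,s,q)+q^{n-1}sT_{n-2}(x,s,q)$ for $n\ge2$. -}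

module Defs where

open import Level using (Level; suc; _⊔_)
open import Algebra.Bundles using (CommutativeRing)
open import Data.Nat as ℕ using (ℕ; zero; _∸_; ⌊_/2⌋; _%_)
import Data.Nat
open import Relation.Nullary using (¬_; Dec; yes; no)
open import Relation.Binary.PropositionalEquality using (_≡_)

record Field (c ℓ : Level) : Set (suc (c ⊔ ℓ)) where
  field
    commutativeRing : CommutativeRing c ℓ
  open CommutativeRing commutativeRing public
  field
    _⁻¹      : Carrier → Carrier
    inverseʳ : ∀ x → ¬ (x ≈ 0#) → (x * (x ⁻¹)) ≈ 1#
    0≉1      : ¬ (0# ≈ 1#)

  infixl 7 _/_
  _/_ : Carrier → Carrier → Carrier
  a / b = a * (b ⁻¹)

module QDefs {c ℓ : Level} (F : Field c ℓ) where
  open Field F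

  pow : Carrier → ℕ → Carrier
  pow a zero = 1#
  pow a (ℕ.suc m) = a * pow a m

  sumTo : ℕ → (ℕ → Carrier) → Carrier
  sumTo zero f = f 0
  sumTo (ℕ.suc N) f = sumTo N f + f (ℕ.suc N)

  iverson : ∀ {p} {P : Set p} → Dec P → Carrier
  iverson (yes _) = 1#
  iverson (no _) = 0#

  module _ (q : Carrier) where
    qint : ℕ → Carrier
    qint zero = 0#
    qint (ℕ.suc m) = qint m + pow q m

    qfact : ℕ → Carrier
    qfact zero = 1#
    qfact (ℕ.suc m) = qfact m * qint (ℕ.suc m)

    -- q-binomial [m choose j] = [m]! / ([j]! [m-j]!)   (used for 0 ≤ j ≤ m)
    qbinom : ℕ → ℕ → Carrier
    qbinom m j = qfact m / (qfact j * qfact (m ∸ j))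

    prodCount : ℕ → ℕ → Carrier
    prodCount a zero = 1#
    prodCount a (ℕ.suc cnt) = (1# + pow q a) * prodCount (ℕ.suc a) cnt

    -- (1+q^a)...(1+q^b) = Π_{i=a}^{b} (1+q^i), equal to 1 if b < a
    prodOnePlus : ℕ → ℕ → Carrier
    prodOnePlus a b = prodCount a (ℕ.suc b ∸ a)

    T : ℕ → Carrier → Carrier → Carrier
    T zero x s = 1#
    T (ℕ.suc zero) x s = x
    T (ℕ.suc (ℕ.suc n)) x s =
      (1# + pow q (ℕ.suc n)) * x * T (ℕ.suc n) x s + pow q (ℕ.suc n) * s * T n x s

    term₁ : ℕ → Carrier → Carrier → ℕ → Carrier
    term₁ n x s k =
      pow q (k ℕ.* k)
        * (prodOnePlus 1 (n ∸ 1) / (prodOnePlus 1 k * prodOnePlus (n ∸ k) (n ∸ 1)))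
        * (qint n / qint (n ∸ k))
        * qbinom (n ∸ k) k
        * pow s k * pow x (n ∸ 2 ℕ.* k)

    sum₁ : ℕ → Carrier → Carrier → Carrier
    sum₁ n x s = sumTo ⌊ n /2⌋ (term₁ n x s)

    term₂ : ℕ → Carrier → Carrier → ℕ → Carrier
    term₂ n x s k =
      pow q (k ℕ.* k)
        * prodOnePlus (ℕ.suc k) (n ∸ k ∸ 1)
        * (qint n / qint (n ∸ k))
        * qbinom (n ∸ k) k
        * pow s k * pow x (n ∸ 2 ℕ.* k)

    -- [n ≡ 0 mod 2] q^{n²/4} s^{n/2}; for even n, n²/4 = ⌊n/2⌋²
    sum₂ : ℕ → Carrier → Carrier → Carrier
    sum₂ n x s = sumTo ⌊ n ∸ 1 /2⌋ (term₂ n x s)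
      + iverson (n % 2 ℕ.≟ 0) * pow q (⌊ n /2⌋ ℕ.* ⌊ n /2⌋) * pow s ⌊ n /2⌋

-- Writing T_n(x,s) = Σ_k c(n,k) s^k x^(n-2k), the coefficients obey the recursion of T:
-- c(n+2,k+1) = (1+q^(n+1)) c(n+1,k+1) + q^(n+1) c(n,k). A double induction on k and m gives
-- c(2k+m,k) = q^(k²) [2k+m] [2][4]⋯[2(k+m-1)] / ([2][4]⋯[2k] [m]!), the induction step being a
-- polynomial identity in q-1, [k], [m] once every q^a is written as 1 + (q-1)[a]. Since
-- (1+q^i)[i] = [2i], expanding the q-binomial and the products of (1+q^i) in the first sum yields
-- exactly this closed form. The second sum agrees term by term after cancelling
-- (1+q)⋯(1+q^k) (1+q^(n-k))⋯(1+q^(n-1)) against (1+q)⋯(1+q^(n-1)), except for the middle term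
-- k = n/2 of an even n, which is c(2k,k) s^k = q^(k²) s^k.

module Submission where

open import Defs
open import Level using (Level)
open import Data.Nat as ℕ using (ℕ; zero; suc; _≤_; _<_; z≤n; s≤s; ⌊_/2⌋)
import Data.Nat.Properties as ℕ
import Data.Nat.DivMod as DivMod
open import Data.Product using (Σ; _×_; _,_)
open import Relation.Nullary using (¬_; Dec; yes; no; contradiction)
open import Relation.Binary.PropositionalEquality as ≡ using (_≡_)
import Algebra.Solver.Ring.NaturalCoefficients.Default as RingSolver

k*2≡k+k : ∀ k → k ℕ.* 2 ≡ k ℕ.+ k
k*2≡k+k k = ≡.trans (ℕ.*-comm k 2) (≡.cong (k ℕ.+_) (ℕ.+-identityʳ k))

suc-square : ∀ k → suc k ℕ.* suc k ≡ suc (k ℕ.* 2 ℕ.+ k ℕ.* k)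
suc-square k = ≡.cong suc (begin
  k ℕ.+ k ℕ.* suc k      ≡⟨ ≡.cong (k ℕ.+_) (ℕ.*-suc k k) ⟩
  k ℕ.+ (k ℕ.+ k ℕ.* k)  ≡⟨ ≡.sym (ℕ.+-assoc k k (k ℕ.* k)) ⟩
  k ℕ.+ k ℕ.+ k ℕ.* k    ≡⟨ ≡.cong (ℕ._+ k ℕ.* k) (≡.sym (k*2≡k+k k)) ⟩
  k ℕ.* 2 ℕ.+ k ℕ.* k    ∎)
  where open ≡.≡-Reasoning

1+k*2<k+1+k+1 : ∀ k → suc (k ℕ.* 2) < suc k ℕ.+ suc k
1+k*2<k+1+k+1 k = ℕ.≤-reflexive (≡.cong suc (≡.trans (≡.cong suc (k*2≡k+k k)) (≡.sym (ℕ.+-suc k k))))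

2*k≤n⇒n≡k+[k+[n∸2*k]] : ∀ {n} k → 2 ℕ.* k ≤ n → n ≡ k ℕ.+ (k ℕ.+ (n ℕ.∸ 2 ℕ.* k))
2*k≤n⇒n≡k+[k+[n∸2*k]] {n} k 2k≤n = begin
  n                                      ≡⟨ ≡.sym (ℕ.m+[n∸m]≡n 2k≤n) ⟩
  k ℕ.+ (k ℕ.+ 0) ℕ.+ (n ℕ.∸ 2 ℕ.* k)    ≡⟨ ≡.cong (λ i → k ℕ.+ i ℕ.+ (n ℕ.∸ 2 ℕ.* k)) (ℕ.+-identityʳ k) ⟩
  k ℕ.+ k ℕ.+ (n ℕ.∸ 2 ℕ.* k)            ≡⟨ ℕ.+-assoc k k _ ⟩
  k ℕ.+ (k ℕ.+ (n ℕ.∸ 2 ℕ.* k))          ∎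
  where open ≡.≡-Reasoning

k≤⌊n/2⌋⇒2*k≤n : ∀ {n k} → k ≤ ⌊ n /2⌋ → 2 ℕ.* k ≤ n
k≤⌊n/2⌋⇒2*k≤n {n} {k} k≤⌊n/2⌋ = ℕ.≤-trans (ℕ.*-monoʳ-≤ 2 k≤⌊n/2⌋)
  (ℕ.≤-trans (ℕ.+-monoʳ-≤ ⌊ n /2⌋ (ℕ.≤-trans (ℕ.≤-reflexive (ℕ.+-identityʳ _)) (ℕ.⌊n/2⌋≤⌈n/2⌉ n)))
             (ℕ.≤-reflexive (ℕ.⌊n/2⌋+⌈n/2⌉≡n n)))

1≤k+[k+m]⇒k+m≡suc : ∀ k m → 1 ≤ k ℕ.+ (k ℕ.+ m) → Σ ℕ (λ j → k ℕ.+ m ≡ suc j)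
1≤k+[k+m]⇒k+m≡suc (suc k) m       _  = k ℕ.+ m , ≡.refl
1≤k+[k+m]⇒k+m≡suc zero    (suc m) _  = m , ≡.refl
1≤k+[k+m]⇒k+m≡suc zero    zero    ()

data EvenOdd : ℕ → Set where
  even : ∀ h → EvenOdd (h ℕ.+ h)
  odd  : ∀ h → EvenOdd (suc (h ℕ.+ h))

evenOdd : ∀ n → EvenOdd n
evenOdd zero = even 0
evenOdd (suc n) with evenOdd n
... | even h = odd h
... | odd h  = ≡.subst EvenOdd (≡.cong suc (ℕ.+-suc h h)) (even (suc h))

module _ {c ℓ : Level} (F : Field c ℓ) where
  open Field F hiding (zero)
  open QDefs F
  open RingSolver commutativeSemiring
  open import Relation.Binary.Reasoning.Setoid setoid

  1≉0 : ¬ 1# ≈ 0#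
  1≉0 1≈0 = 0≉1 (sym 1≈0)

  *-cancelʳ-≉0 : ∀ {a b d} → ¬ d ≈ 0# → a * d ≈ b * d → a ≈ b
  *-cancelʳ-≉0 {a} {b} {d} d≉0 ad≈bd = begin
    a                ≈⟨ solve 1 (λ a → a := a :* con 1) refl a ⟩
    a * 1#           ≈⟨ *-congˡ (sym (inverseʳ d d≉0)) ⟩
    a * (d * d ⁻¹)   ≈⟨ solve 3 (λ a d e → a :* (d :* e) := (a :* d) :* e) refl a d (d ⁻¹) ⟩
    (a * d) * d ⁻¹   ≈⟨ *-congʳ ad≈bd ⟩
    (b * d) * d ⁻¹   ≈⟨ solve 3 (λ b d e → (b :* d) :* e := b :* (d :* e)) refl b d (d ⁻¹) ⟩
    b * (d * d ⁻¹)   ≈⟨ *-congˡ (inverseʳ d d≉0) ⟩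
    b * 1#           ≈⟨ solve 1 (λ b → b :* con 1 := b) refl b ⟩
    b                ∎

  x≉0∧y≉0⇒x*y≉0 : ∀ {x y} → ¬ x ≈ 0# → ¬ y ≈ 0# → ¬ x * y ≈ 0#
  x≉0∧y≉0⇒x*y≉0 {x} {y} x≉0 y≉0 xy≈0 =
    x≉0 (*-cancelʳ-≉0 y≉0 (trans xy≈0 (sym (zeroˡ y))))

  iverson-yes : ∀ {p} {P : Set p} (P? : Dec P) → P → iverson P? ≈ 1#
  iverson-yes (yes _) _ = refl
  iverson-yes (no ¬p) p = contradiction p ¬p

  iverson-no : ∀ {p} {P : Set p} (P? : Dec P) → ¬ P → iverson P? ≈ 0#
  iverson-no (yes p) ¬p = contradiction p ¬p
  iverson-no (no _)  _  = refl

  sumTo-cong : ∀ N {f g} → (∀ k → k ≤ N → f k ≈ g k) → sumTo N f ≈ sumTo N g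
  sumTo-cong zero    f≈g = f≈g 0 z≤n
  sumTo-cong (suc N) f≈g =
    +-cong (sumTo-cong N (λ k k≤N → f≈g k (ℕ.m≤n⇒m≤1+n k≤N))) (f≈g (suc N) ℕ.≤-refl)

  sumTo-suc : ∀ N f → sumTo (suc N) f ≈ f 0 + sumTo N (λ k → f (suc k))
  sumTo-suc zero    f = refl
  sumTo-suc (suc N) f = trans (+-congʳ (sumTo-suc N f)) (+-assoc _ _ _)

  sumTo-+ : ∀ N f g → sumTo N (λ k → f k + g k) ≈ sumTo N f + sumTo N g
  sumTo-+ zero    f g = refl
  sumTo-+ (suc N) f g = trans (+-congʳ (sumTo-+ N f g))
    (solve 4 (λ a b c d → (a :+ b) :+ (c :+ d) := (a :+ c) :+ (b :+ d)) refl _ _ _ _)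

  *-distribˡ-sumTo : ∀ N a f → a * sumTo N f ≈ sumTo N (λ k → a * f k)
  *-distribˡ-sumTo zero    a f = refl
  *-distribˡ-sumTo (suc N) a f = trans (distribˡ _ _ _) (+-congʳ (*-distribˡ-sumTo N a f))

  sumTo-head : ∀ N f → (∀ k → f (suc k) ≈ 0#) → sumTo N f ≈ f 0
  sumTo-head zero    f tail≈0 = refl
  sumTo-head (suc N) f tail≈0 =
    trans (+-cong (sumTo-head N f tail≈0) (tail≈0 N)) (+-identityʳ _)

  pow-+ : ∀ a m n → pow a (m ℕ.+ n) ≈ pow a m * pow a n
  pow-+ a zero    n = sym (*-identityˡ _)
  pow-+ a (suc m) n = trans (*-congˡ (pow-+ a m n)) (sym (*-assoc _ _ _))

  pow-suc-∸ : ∀ a {n d} → d ≤ n → pow a (suc n ℕ.∸ d) ≈ a * pow a (n ℕ.∸ d)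
  pow-suc-∸ a d≤n = reflexive (≡.cong (pow a) (ℕ.+-∸-assoc 1 d≤n))

  module _ (q : Carrier) where

    qint-suc : ∀ a → qint q (suc a) ≈ 1# + q * qint q a
    qint-suc zero    = solve 1 (λ q → con 0 :+ con 1 := con 1 :+ q :* con 0) refl q
    qint-suc (suc a) = trans (+-congʳ (qint-suc a))
      (solve 3 (λ q x y → (con 1 :+ q :* x) :+ q :* y := con 1 :+ q :* (x :+ y)) refl q _ _)

    qint-+ : ∀ a b → qint q (a ℕ.+ b) ≈ qint q a + pow q a * qint q b
    qint-+ zero    b = solve 1 (λ x → x := con 0 :+ con 1 :* x) refl (qint q b)
    qint-+ (suc a) b = begin
      qint q (suc (a ℕ.+ b))                    ≈⟨ qint-suc (a ℕ.+ b) ⟩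
      1# + q * qint q (a ℕ.+ b)                 ≈⟨ +-congˡ (*-congˡ (qint-+ a b)) ⟩
      1# + q * (qint q a + pow q a * qint q b)  ≈⟨ solve 4 (λ q x y z → con 1 :+ q :* (x :+ y :* z)
                                                     := (con 1 :+ q :* x) :+ (q :* y) :* z) refl q _ _ _ ⟩
      (1# + q * qint q a) + q * pow q a * qint q b ≈⟨ +-congʳ (sym (qint-suc a)) ⟩
      qint q (suc a) + pow q (suc a) * qint q b ∎

    qint-double : ∀ a → qint q (a ℕ.+ a) ≈ (1# + pow q a) * qint q a
    qint-double a = trans (qint-+ a a)
      (solve 2 (λ x y → x :+ y :* x := (con 1 :+ y) :* x) refl (qint q a) (pow q a))

    q≈1+[q-1] : q ≈ 1# + (q - 1#)
    q≈1+[q-1] = begin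
      q                ≈⟨ sym (+-identityʳ q) ⟩
      q + 0#           ≈⟨ +-congˡ (sym (-‿inverseˡ 1#)) ⟩
      q + (- 1# + 1#)  ≈⟨ sym (+-assoc _ _ _) ⟩
      (q - 1#) + 1#    ≈⟨ +-comm _ _ ⟩
      1# + (q - 1#)    ∎

    pow≈1+[q-1]qint : ∀ a → pow q a ≈ 1# + (q - 1#) * qint q a
    pow≈1+[q-1]qint zero    = solve 1 (λ p → con 1 := con 1 :+ p :* con 0) refl (q - 1#)
    pow≈1+[q-1]qint (suc a) = begin
      q * pow q a                        ≈⟨ *-cong q≈1+[q-1] (pow≈1+[q-1]qint a) ⟩
      (1# + p) * (1# + p * qint q a)     ≈⟨ solve 2 (λ p k → (con 1 :+ p) :* (con 1 :+ p :* k)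
                                              := con 1 :+ p :* (con 1 :+ (con 1 :+ p) :* k)) refl p (qint q a) ⟩
      1# + p * (1# + (1# + p) * qint q a) ≈⟨ +-congˡ (*-congˡ (sym (trans (qint-suc a) (+-congˡ (*-congʳ q≈1+[q-1]))))) ⟩
      1# + p * qint q (suc a)            ∎
      where p = q - 1#

    prodCount-+ : ∀ a b d → prodCount q a (b ℕ.+ d) ≈ prodCount q a b * prodCount q (a ℕ.+ b) d
    prodCount-+ a zero    d = trans (reflexive (≡.cong (λ i → prodCount q i d) (≡.sym (ℕ.+-identityʳ a))))
                                    (sym (*-identityˡ _))
    prodCount-+ a (suc b) d = begin
      (1# + pow q a) * prodCount q (suc a) (b ℕ.+ d)
        ≈⟨ *-congˡ (prodCount-+ (suc a) b d) ⟩
      (1# + pow q a) * (prodCount q (suc a) b * prodCount q (suc a ℕ.+ b) d)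
        ≈⟨ sym (*-assoc _ _ _) ⟩
      (1# + pow q a) * prodCount q (suc a) b * prodCount q (suc a ℕ.+ b) d
        ≈⟨ reflexive (≡.cong (λ i → (1# + pow q a) * prodCount q (suc a) b * prodCount q i d) (≡.sym (ℕ.+-suc a b))) ⟩
      (1# + pow q a) * prodCount q (suc a) b * prodCount q (a ℕ.+ suc b) d ∎

    prodCount-suc : ∀ a b → prodCount q a (suc b) ≈ prodCount q a b * (1# + pow q (a ℕ.+ b))
    prodCount-suc a b = begin
      prodCount q a (suc b)            ≈⟨ reflexive (≡.cong (prodCount q a) (ℕ.+-comm 1 b)) ⟩
      prodCount q a (b ℕ.+ 1)          ≈⟨ prodCount-+ a b 1 ⟩
      prodCount q a b * ((1# + pow q (a ℕ.+ b)) * 1#) ≈⟨ *-congˡ (*-identityʳ _) ⟩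
      prodCount q a b * (1# + pow q (a ℕ.+ b)) ∎

    -- [2][4]⋯[2j], since (1 + q^i) [i] = [2i]
    qEvenFact : ℕ → Carrier
    qEvenFact j = prodCount q 1 j * qfact q j

    qEvenFact-suc : ∀ j → qEvenFact (suc j) ≈ qEvenFact j * qint q (suc j ℕ.+ suc j)
    qEvenFact-suc j = begin
      prodCount q 1 (suc j) * (qfact q j * qint q (suc j))
        ≈⟨ *-congʳ (prodCount-suc 1 j) ⟩
      prodCount q 1 j * (1# + pow q (suc j)) * (qfact q j * qint q (suc j))
        ≈⟨ solve 4 (λ e a f b → e :* a :* (f :* b) := e :* f :* (a :* b)) refl _ _ _ _ ⟩
      qEvenFact j * ((1# + pow q (suc j)) * qint q (suc j))
        ≈⟨ *-congˡ (sym (qint-double (suc j))) ⟩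
      qEvenFact j * qint q (suc j ℕ.+ suc j) ∎

    -- coeff n k is the coefficient of s^k x^(n-2k) in T_n.
    coeff : ℕ → ℕ → Carrier
    coeff 0             0       = 1#
    coeff 0             (suc k) = 0#
    coeff 1             0       = 1#
    coeff 1             (suc k) = 0#
    coeff (suc (suc n)) 0       = (1# + pow q (suc n)) * coeff (suc n) 0
    coeff (suc (suc n)) (suc k) = (1# + pow q (suc n)) * coeff (suc n) (suc k) + pow q (suc n) * coeff n k

    coeff-vanishes : ∀ n k → n < k ℕ.+ k → coeff n k ≈ 0#
    coeff-vanishes 0             (suc k) _ = refl
    coeff-vanishes 1             (suc k) _ = refl
    coeff-vanishes (suc (suc n)) (suc k) (s≤s n+1<k+1+k) = begin
      (1# + pow q (suc n)) * coeff (suc n) (suc k) + pow q (suc n) * coeff n k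
        ≈⟨ +-cong (*-congˡ (coeff-vanishes (suc n) (suc k) (ℕ.m≤n⇒m≤1+n n+1<k+1+k)))
                  (*-congˡ (coeff-vanishes n k n<k+k)) ⟩
      (1# + pow q (suc n)) * 0# + pow q (suc n) * 0#
        ≈⟨ solve 2 (λ a b → a :* con 0 :+ b :* con 0 := con 0) refl _ _ ⟩
      0# ∎
      where
      n<k+k : n < k ℕ.+ k
      n<k+k = ℕ.≤-pred (≡.subst (suc (suc n) ≤_) (ℕ.+-suc k k) n+1<k+1+k)

    coeff-suc-zero : ∀ m → coeff (suc m) 0 ≈ prodCount q 1 m
    coeff-suc-zero zero    = refl
    coeff-suc-zero (suc m) = begin
      (1# + pow q (suc m)) * coeff (suc m) 0    ≈⟨ *-congˡ (coeff-suc-zero m) ⟩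
      (1# + pow q (suc m)) * prodCount q 1 m    ≈⟨ *-comm _ _ ⟩
      prodCount q 1 m * (1# + pow q (suc m))    ≈⟨ sym (prodCount-suc 1 m) ⟩
      prodCount q 1 (suc m)                     ∎

    coeff-diagonal : ∀ k → coeff (k ℕ.* 2) k ≈ pow q (k ℕ.* k)
    coeff-diagonal zero    = refl
    coeff-diagonal (suc k) = begin
      (1# + B) * coeff (suc (k ℕ.* 2)) (suc k) + B * coeff (k ℕ.* 2) k
        ≈⟨ +-cong (*-congˡ (coeff-vanishes _ _ (1+k*2<k+1+k+1 k))) (*-congˡ (coeff-diagonal k)) ⟩
      (1# + B) * 0# + B * pow q (k ℕ.* k)
        ≈⟨ trans (+-congʳ (zeroʳ _)) (+-identityˡ _) ⟩
      B * pow q (k ℕ.* k)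
        ≈⟨ sym (pow-+ q (suc (k ℕ.* 2)) (k ℕ.* k)) ⟩
      pow q (suc (k ℕ.* 2 ℕ.+ k ℕ.* k))
        ≈⟨ reflexive (≡.cong (pow q) (≡.sym (suc-square k))) ⟩
      pow q (suc k ℕ.* suc k) ∎
      where B = pow q (suc (k ℕ.* 2))

    module _ (x s : Carrier) where

      monomial : ℕ → ℕ → Carrier
      monomial n k = coeff n k * pow s k * pow x (n ℕ.∸ 2 ℕ.* k)

      monomial-suc : ∀ n k → monomial (suc (suc n)) (suc k)
        ≈ (1# + pow q (suc n)) * x * monomial (suc n) (suc k) + pow q (suc n) * s * monomial n k
      monomial-suc n k = begin
        (A * c₁ + B * c₀) * (s * S) * X₂
          ≈⟨ solve 7 (λ A c₁ B c₀ s S X₂ → (A :* c₁ :+ B :* c₀) :* (s :* S) :* X₂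
                        := A :* (c₁ :* (s :* S) :* X₂) :+ B :* s :* (c₀ :* S :* X₂)) refl A c₁ B c₀ s S X₂ ⟩
        A * (c₁ * (s * S) * X₂) + B * s * (c₀ * S * X₂)
          ≈⟨ +-cong (*-congˡ drop-x) (*-congˡ (*-congˡ X₂≈X₀)) ⟩
        A * (x * (c₁ * (s * S) * X₁)) + B * s * (c₀ * S * X₀)
          ≈⟨ +-congʳ (sym (*-assoc _ _ _)) ⟩
        A * x * (c₁ * (s * S) * X₁) + B * s * (c₀ * S * X₀) ∎
        where
        A  = 1# + pow q (suc n)
        B  = pow q (suc n)
        c₁ = coeff (suc n) (suc k)
        c₀ = coeff n k
        S  = pow s k
        X₂ = pow x (suc (suc n) ℕ.∸ 2 ℕ.* suc k)
        X₁ = pow x (suc n ℕ.∸ 2 ℕ.* suc k)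
        X₀ = pow x (n ℕ.∸ 2 ℕ.* k)
        X₂≈X₀ : X₂ ≈ X₀
        X₂≈X₀ = reflexive (≡.cong (λ d → pow x (suc (suc n) ℕ.∸ d)) (ℕ.*-suc 2 k))
        -- when 2(k+1) > n+1 the exponents are truncated, but then c₁ = 0
        drop-x : c₁ * (s * S) * X₂ ≈ x * (c₁ * (s * S) * X₁)
        drop-x with 2 ℕ.* suc k ℕ.≤? suc n
        ... | yes 2k+2≤n+1 = trans (*-congˡ (pow-suc-∸ x 2k+2≤n+1))
          (solve 4 (λ c y x X → c :* y :* (x :* X) := x :* (c :* y :* X)) refl c₁ (s * S) x X₁)
        ... | no  2k+2≰n+1 = begin
          c₁ * (s * S) * X₂        ≈⟨ *-congʳ (*-congʳ c₁≈0) ⟩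
          0# * (s * S) * X₂        ≈⟨ solve 4 (λ y X₂ x X₁ → con 0 :* y :* X₂ := x :* (con 0 :* y :* X₁))
                                          refl (s * S) X₂ x X₁ ⟩
          x * (0# * (s * S) * X₁)  ≈⟨ *-congˡ (*-congʳ (*-congʳ (sym c₁≈0))) ⟩
          x * (c₁ * (s * S) * X₁)  ∎
          where
          c₁≈0 : c₁ ≈ 0#
          c₁≈0 = coeff-vanishes (suc n) (suc k)
            (≡.subst (suc n <_) (≡.cong (suc k ℕ.+_) (ℕ.+-identityʳ (suc k))) (ℕ.≰⇒> 2k+2≰n+1))

      T≈sumTo-monomial : ∀ n N → ⌊ n /2⌋ ≤ N → T q n x s ≈ sumTo N (monomial n)
      T≈sumTo-monomial 0 N _ =
        sym (trans (sumTo-head N (monomial 0) (λ k → solve 2 (λ a b → con 0 :* a :* b := con 0) refl _ _))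
                   (solve 0 (con 1 :* con 1 :* con 1 := con 1) refl))
      T≈sumTo-monomial 1 N _ =
        sym (trans (sumTo-head N (monomial 1) (λ k → solve 2 (λ a b → con 0 :* a :* b := con 0) refl _ _))
                   (solve 1 (λ x → con 1 :* con 1 :* (x :* con 1) := x) refl x))
      T≈sumTo-monomial (suc (suc n)) (suc N) (s≤s ⌊n/2⌋≤N) = begin
        A * x * T q (suc n) x s + B * s * T q n x s
          ≈⟨ +-cong (*-congˡ (T≈sumTo-monomial (suc n) (suc N) ⌊n+1/2⌋≤N+1))
                    (*-congˡ (T≈sumTo-monomial n N ⌊n/2⌋≤N)) ⟩
        A * x * sumTo (suc N) (monomial (suc n)) + B * s * sumTo N (monomial n)
          ≈⟨ +-congʳ (trans (*-congˡ (sumTo-suc N _)) (distribˡ _ _ _)) ⟩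
        (A * x * monomial (suc n) 0 + A * x * sumTo N (λ k → monomial (suc n) (suc k)))
          + B * s * sumTo N (monomial n)
          ≈⟨ +-assoc _ _ _ ⟩
        A * x * monomial (suc n) 0
          + (A * x * sumTo N (λ k → monomial (suc n) (suc k)) + B * s * sumTo N (monomial n))
          ≈⟨ +-congˡ (trans (+-cong (*-distribˡ-sumTo N _ _) (*-distribˡ-sumTo N _ _)) (sym (sumTo-+ N _ _))) ⟩
        A * x * monomial (suc n) 0
          + sumTo N (λ k → A * x * monomial (suc n) (suc k) + B * s * monomial n k)
          ≈⟨ +-cong head (sumTo-cong N (λ k _ → sym (monomial-suc n k))) ⟩
        monomial (suc (suc n)) 0 + sumTo N (λ k → monomial (suc (suc n)) (suc k))
          ≈⟨ sym (sumTo-suc N _) ⟩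
        sumTo (suc N) (monomial (suc (suc n))) ∎
        where
        A = 1# + pow q (suc n)
        B = pow q (suc n)
        ⌊n+1/2⌋≤N+1 : ⌊ suc n /2⌋ ≤ suc N
        ⌊n+1/2⌋≤N+1 = ℕ.≤-trans (ℕ.⌊n/2⌋-mono (ℕ.n≤1+n (suc n))) (s≤s ⌊n/2⌋≤N)
        head : A * x * monomial (suc n) 0 ≈ monomial (suc (suc n)) 0
        head = solve 4 (λ A x c X → A :* x :* (c :* con 1 :* X) := A :* c :* con 1 :* (x :* X))
                 refl A x (coeff (suc n) 0) (pow x (suc n))

    -- Substituting q = 1 + p turns q^a into 1 + p [a], so that both sides become
    -- polynomials in p, [k], [m] and q^(k²).
    coeff-step-identity : ∀ k m → let n = k ℕ.* 2 ℕ.+ m in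
      pow q (suc k ℕ.* suc k) * qint q (suc (suc n)) * qint q ((k ℕ.+ m) ℕ.+ (k ℕ.+ m))
        ≈ (1# + pow q (suc n)) * pow q (suc k ℕ.* suc k) * qint q (suc n) * qint q m
          + pow q (suc n) * pow q (k ℕ.* k) * qint q n * qint q (suc k ℕ.+ suc k)
    coeff-step-identity k m = trans lhs≈ (trans polynomial-identity (sym rhs≈))
      where
      n = k ℕ.* 2 ℕ.+ m
      p = q - 1#
      K = qint q k
      M = qint q m
      Q = pow q (k ℕ.* k)
      u = 1# + p * K
      v = 1# + p * M
      Pₙ = u * u * v
      Nₙ = (K + u * K) + u * u * M
      Wₖₘ = (K + u * M) + u * v * (K + u * M)
      Dₖ = (K + u) + (1# + p) * u * (K + u)

      q^k≈u : pow q k ≈ u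
      q^k≈u = pow≈1+[q-1]qint k
      q^m≈v : pow q m ≈ v
      q^m≈v = pow≈1+[q-1]qint m
      q^[k*2]≈uu : pow q (k ℕ.* 2) ≈ u * u
      q^[k*2]≈uu = trans (reflexive (≡.cong (pow q) (k*2≡k+k k))) (trans (pow-+ q k k) (*-cong q^k≈u q^k≈u))
      q^[k+1]²≈ : pow q (suc k ℕ.* suc k) ≈ (1# + p) * (u * u) * Q
      q^[k+1]²≈ = begin
        pow q (suc k ℕ.* suc k)                        ≈⟨ reflexive (≡.cong (pow q) (suc-square k)) ⟩
        q * pow q (k ℕ.* 2 ℕ.+ k ℕ.* k)                ≈⟨ *-cong q≈1+[q-1] (pow-+ q (k ℕ.* 2) (k ℕ.* k)) ⟩
        (1# + p) * (pow q (k ℕ.* 2) * Q)               ≈⟨ trans (*-congˡ (*-congʳ q^[k*2]≈uu)) (sym (*-assoc _ _ _)) ⟩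
        (1# + p) * (u * u) * Q                         ∎
      q^n≈ : pow q n ≈ Pₙ
      q^n≈ = trans (pow-+ q (k ℕ.* 2) m) (*-cong q^[k*2]≈uu q^m≈v)
      q^[n+1]≈ : pow q (suc n) ≈ (1# + p) * Pₙ
      q^[n+1]≈ = *-cong q≈1+[q-1] q^n≈
      [k*2]≈ : qint q (k ℕ.* 2) ≈ K + u * K
      [k*2]≈ = trans (reflexive (≡.cong (qint q) (k*2≡k+k k))) (trans (qint-+ k k) (+-congˡ (*-congʳ q^k≈u)))
      [n]≈ : qint q n ≈ Nₙ
      [n]≈ = trans (qint-+ (k ℕ.* 2) m) (+-cong [k*2]≈ (*-congʳ q^[k*2]≈uu))
      [k+m]≈ : qint q (k ℕ.+ m) ≈ K + u * M
      [k+m]≈ = trans (qint-+ k m) (+-congˡ (*-congʳ q^k≈u))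
      [2[k+m]]≈ : qint q ((k ℕ.+ m) ℕ.+ (k ℕ.+ m)) ≈ Wₖₘ
      [2[k+m]]≈ = trans (qint-+ (k ℕ.+ m) (k ℕ.+ m)) (+-cong [k+m]≈ (*-cong (trans (pow-+ q k m) (*-cong q^k≈u q^m≈v)) [k+m]≈))
      [2[k+1]]≈ : qint q (suc k ℕ.+ suc k) ≈ Dₖ
      [2[k+1]]≈ = trans (qint-+ (suc k) (suc k))
        (+-cong (+-congˡ q^k≈u) (*-cong (*-cong q≈1+[q-1] q^k≈u) (+-congˡ q^k≈u)))

      lhs≈ : pow q (suc k ℕ.* suc k) * qint q (suc (suc n)) * qint q ((k ℕ.+ m) ℕ.+ (k ℕ.+ m))
           ≈ (1# + p) * (u * u) * Q * ((Nₙ + Pₙ) + (1# + p) * Pₙ) * Wₖₘ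
      lhs≈ = *-cong (*-cong q^[k+1]²≈ (+-cong (+-cong [n]≈ q^n≈) q^[n+1]≈)) [2[k+m]]≈
      rhs≈ : (1# + pow q (suc n)) * pow q (suc k ℕ.* suc k) * qint q (suc n) * qint q m
               + pow q (suc n) * Q * qint q n * qint q (suc k ℕ.+ suc k)
           ≈ (1# + (1# + p) * Pₙ) * ((1# + p) * (u * u) * Q) * (Nₙ + Pₙ) * M + (1# + p) * Pₙ * Q * Nₙ * Dₖ
      rhs≈ = +-cong (*-congʳ (*-cong (*-cong (+-congˡ q^[n+1]≈) q^[k+1]²≈) (+-cong [n]≈ q^n≈)))
                    (*-cong (*-cong (*-congʳ q^[n+1]≈) [n]≈) [2[k+1]]≈)
      polynomial-identity :
        (1# + p) * (u * u) * Q * ((Nₙ + Pₙ) + (1# + p) * Pₙ) * Wₖₘ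
          ≈ (1# + (1# + p) * Pₙ) * ((1# + p) * (u * u) * Q) * (Nₙ + Pₙ) * M + (1# + p) * Pₙ * Q * Nₙ * Dₖ
      polynomial-identity = solve 4 (λ p K M Q →
        let q′ = con 1 :+ p
            u′ = con 1 :+ p :* K
            v′ = con 1 :+ p :* M
            P′ = u′ :* u′ :* v′
            N′ = (K :+ u′ :* K) :+ u′ :* u′ :* M
            W′ = (K :+ u′ :* M) :+ u′ :* v′ :* (K :+ u′ :* M)
            D′ = (K :+ u′) :+ q′ :* u′ :* (K :+ u′)
        in  q′ :* (u′ :* u′) :* Q :* ((N′ :+ P′) :+ q′ :* P′) :* W′
         := (con 1 :+ q′ :* P′) :* (q′ :* (u′ :* u′) :* Q) :* (N′ :+ P′) :* M :+ q′ :* P′ :* Q :* N′ :* D′)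
        refl p K M Q

    -- The closed form of c(2k+m,k) with denominators cleared; the extra factor [2(k+m)]
    -- keeps it true for k = m = 0.
    ClosedForm : ℕ → ℕ → Set ℓ
    ClosedForm k m = coeff (k ℕ.* 2 ℕ.+ m) k * qEvenFact k * qfact q m * qint q ((k ℕ.+ m) ℕ.+ (k ℕ.+ m))
                   ≈ pow q (k ℕ.* k) * qint q (k ℕ.* 2 ℕ.+ m) * qEvenFact (k ℕ.+ m)

    -- ClosedForm (k + 1) (m - 1) multiplied by [m]; for m = 0 both sides vanish.
    ClosedForm′ : ℕ → ℕ → Set ℓ
    ClosedForm′ k m = coeff (suc (k ℕ.* 2 ℕ.+ m)) (suc k) * qEvenFact (suc k) * qfact q m * qint q ((k ℕ.+ m) ℕ.+ (k ℕ.+ m))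
                    ≈ pow q (suc k ℕ.* suc k) * qint q (suc (k ℕ.* 2 ℕ.+ m)) * qEvenFact (k ℕ.+ m) * qint q m

    closedForm-step : ∀ k m → ¬ qint q ((k ℕ.+ m) ℕ.+ (k ℕ.+ m)) ≈ 0# →
                      ClosedForm′ k m → ClosedForm k m → ClosedForm (suc k) m
    closedForm-step k m W≉0 closedForm′ closedForm = *-cancelʳ-≉0 W≉0 (begin
      (A * c₁ + B * c₀) * Ek₁ * fm * W′ * W
        ≈⟨ solve 8 (λ A B c₁ c₀ Ek₁ fm W′ W → (A :* c₁ :+ B :* c₀) :* Ek₁ :* fm :* W′ :* W
                      := A :* (c₁ :* Ek₁ :* fm :* W) :* W′ :+ B :* (c₀ :* Ek₁ :* fm :* W) :* W′)
                   refl A B c₁ c₀ Ek₁ fm W′ W ⟩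
      A * (c₁ * Ek₁ * fm * W) * W′ + B * (c₀ * Ek₁ * fm * W) * W′
        ≈⟨ +-cong (*-congʳ (*-congˡ closedForm′)) (*-congʳ (*-congˡ (*-congʳ (*-congʳ (*-congˡ (qEvenFact-suc k)))))) ⟩
      A * (Qk₁ * N₁ * Ekm * M) * W′ + B * (c₀ * (Ek * D) * fm * W) * W′
        ≈⟨ +-congˡ (solve 7 (λ B c₀ Ek D fm W W′ → B :* (c₀ :* (Ek :* D) :* fm :* W) :* W′
                              := B :* D :* (c₀ :* Ek :* fm :* W) :* W′) refl B c₀ Ek D fm W W′) ⟩
      A * (Qk₁ * N₁ * Ekm * M) * W′ + B * D * (c₀ * Ek * fm * W) * W′
        ≈⟨ +-congˡ (*-congʳ (*-congˡ closedForm)) ⟩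
      A * (Qk₁ * N₁ * Ekm * M) * W′ + B * D * (Qk * N * Ekm) * W′
        ≈⟨ solve 10 (λ A Qk₁ N₁ Ekm M W′ B D Qk N →
                         A :* (Qk₁ :* N₁ :* Ekm :* M) :* W′ :+ B :* D :* (Qk :* N :* Ekm) :* W′
                       := (A :* Qk₁ :* N₁ :* M :+ B :* Qk :* N :* D) :* (Ekm :* W′))
                    refl A Qk₁ N₁ Ekm M W′ B D Qk N ⟩
      (A * Qk₁ * N₁ * M + B * Qk * N * D) * (Ekm * W′)
        ≈⟨ *-congʳ (sym (coeff-step-identity k m)) ⟩
      Qk₁ * N₂ * W * (Ekm * W′)
        ≈⟨ solve 5 (λ Qk₁ N₂ W Ekm W′ → Qk₁ :* N₂ :* W :* (Ekm :* W′) := Qk₁ :* N₂ :* (Ekm :* W′) :* W)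
                   refl Qk₁ N₂ W Ekm W′ ⟩
      Qk₁ * N₂ * (Ekm * W′) * W
        ≈⟨ *-congʳ (*-congˡ (sym (qEvenFact-suc (k ℕ.+ m)))) ⟩
      Qk₁ * N₂ * qEvenFact (suc (k ℕ.+ m)) * W ∎)
      where
      n   = k ℕ.* 2 ℕ.+ m
      A   = 1# + pow q (suc n)
      B   = pow q (suc n)
      c₁  = coeff (suc n) (suc k)
      c₀  = coeff n k
      Ek  = qEvenFact k
      Ek₁ = qEvenFact (suc k)
      Ekm = qEvenFact (k ℕ.+ m)
      fm  = qfact q m
      M   = qint q m
      N   = qint q n
      N₁  = qint q (suc n)
      N₂  = qint q (suc (suc n))
      D   = qint q (suc k ℕ.+ suc k)
      W   = qint q ((k ℕ.+ m) ℕ.+ (k ℕ.+ m))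
      W′  = qint q (suc (k ℕ.+ m) ℕ.+ suc (k ℕ.+ m))
      Qk  = pow q (k ℕ.* k)
      Qk₁ = pow q (suc k ℕ.* suc k)

    closedForm′-zero : ∀ k → ClosedForm′ k 0
    closedForm′-zero k = begin
      coeff (suc n) (suc k) * Ek₁ * 1# * W
        ≈⟨ *-congʳ (*-congʳ (*-congʳ (coeff-vanishes (suc n) (suc k) n+1<k+1+k+1))) ⟩
      0# * Ek₁ * 1# * W
        ≈⟨ solve 5 (λ E W Q N F → con 0 :* E :* con 1 :* W := Q :* N :* F :* con 0)
             refl Ek₁ W (pow q (suc k ℕ.* suc k)) (qint q (suc n)) (qEvenFact (k ℕ.+ 0)) ⟩
      pow q (suc k ℕ.* suc k) * qint q (suc n) * qEvenFact (k ℕ.+ 0) * 0# ∎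
      where
      n   = k ℕ.* 2 ℕ.+ 0
      Ek₁ = qEvenFact (suc k)
      W   = qint q ((k ℕ.+ 0) ℕ.+ (k ℕ.+ 0))
      n+1<k+1+k+1 : suc n < suc k ℕ.+ suc k
      n+1<k+1+k+1 = ≡.subst (λ i → suc i < suc k ℕ.+ suc k) (≡.sym (ℕ.+-identityʳ (k ℕ.* 2))) (1+k*2<k+1+k+1 k)

    closedForm⇒closedForm′ : ∀ k m → ClosedForm (suc k) m → ClosedForm′ k (suc m)
    closedForm⇒closedForm′ k m closedForm = begin
      c₁ * Ek₁ * (fm * M) * W     ≈⟨ solve 5 (λ c E f M W → c :* E :* (f :* M) :* W := c :* E :* f :* W :* M)
                                         refl c₁ Ek₁ fm M W ⟩
      c₁ * Ek₁ * fm * W * M       ≈⟨ *-congʳ reindexed ⟩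
      Qk₁ * qint q (suc (k ℕ.* 2 ℕ.+ suc m)) * qEvenFact (k ℕ.+ suc m) * M ∎
      where
      c₁  = coeff (suc (k ℕ.* 2 ℕ.+ suc m)) (suc k)
      Ek₁ = qEvenFact (suc k)
      fm  = qfact q m
      M   = qint q (suc m)
      W   = qint q ((k ℕ.+ suc m) ℕ.+ (k ℕ.+ suc m))
      Qk₁ = pow q (suc k ℕ.* suc k)
      reindexed : c₁ * Ek₁ * fm * W ≈ Qk₁ * qint q (suc (k ℕ.* 2 ℕ.+ suc m)) * qEvenFact (k ℕ.+ suc m)
      reindexed = ≡.subst₂ (λ a b → coeff (suc a) (suc k) * Ek₁ * fm * qint q (b ℕ.+ b) ≈ Qk₁ * qint q (suc a) * qEvenFact b)
                    (≡.sym (ℕ.+-suc (k ℕ.* 2) m)) (≡.sym (ℕ.+-suc k m)) closedForm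

    ratio : ℕ → ℕ → ℕ → Carrier
    ratio k a b = prodOnePlus q 1 b / (prodOnePlus q 1 k * prodOnePlus q a b)

    -- term₁ n x s k is definitionally coeff₁ n k (n ∸ k) (n ∸ 1) * s^k * x^(n ∸ 2k).
    coeff₁ : ℕ → ℕ → ℕ → ℕ → Carrier
    coeff₁ n k a b = pow q (k ℕ.* k) * ratio k a b * (qint q n / qint q a) * qbinom q a k

    module _ (qint≉0 : ∀ m → 1 ≤ m → ¬ qint q m ≈ 0#) where

      coeff-closedForm : ∀ k m → ClosedForm k m
      coeff-closedForm zero zero = solve 0 (con 1 :* (con 1 :* con 1) :* con 1 :* con 0 := con 1 :* con 0 :* (con 1 :* con 1)) refl
      coeff-closedForm zero (suc m) = begin
        coeff (suc m) 0 * qEvenFact 0 * (fm * M) * W           ≈⟨ *-congʳ (*-congʳ (*-congʳ (coeff-suc-zero m))) ⟩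
        prodCount q 1 m * qEvenFact 0 * (fm * M) * W           ≈⟨ solve 4 (λ E f M W → E :* (con 1 :* con 1) :* (f :* M) :* W
                                                                    := con 1 :* M :* (E :* f :* W)) refl (prodCount q 1 m) fm M W ⟩
        1# * M * (qEvenFact m * W)                             ≈⟨ *-congˡ (sym (qEvenFact-suc m)) ⟩
        1# * M * qEvenFact (suc m)                             ∎
        where
        fm = qfact q m
        M  = qint q (suc m)
        W  = qint q (suc m ℕ.+ suc m)
      coeff-closedForm (suc zero) zero = solve 1 (λ q →
        let E₁ = ((con 1 :+ q :* con 1) :* con 1) :* (con 1 :* (con 0 :+ con 1))
            D  = (con 0 :+ con 1) :+ q :* con 1
        in ((con 1 :+ q :* con 1) :* con 0 :+ q :* con 1 :* con 1) :* E₁ :* con 1 :* D := q :* con 1 :* D :* E₁) refl q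
      coeff-closedForm (suc (suc k)) zero =
        closedForm-step (suc k) 0 (qint≉0 ((suc k ℕ.+ 0) ℕ.+ (suc k ℕ.+ 0)) (s≤s z≤n))
          (closedForm′-zero (suc k)) (coeff-closedForm (suc k) 0)
      coeff-closedForm (suc k) (suc m) =
        closedForm-step k (suc m) (qint≉0 _ 1≤W)
          (closedForm⇒closedForm′ k m (coeff-closedForm (suc k) m)) (coeff-closedForm k (suc m))
        where
        1≤W : 1 ≤ (k ℕ.+ suc m) ℕ.+ (k ℕ.+ suc m)
        1≤W = ℕ.≤-trans (ℕ.≤-trans (s≤s z≤n) (ℕ.m≤n+m (suc m) k)) (ℕ.m≤m+n _ _)

      qfact≉0 : ∀ j → ¬ qfact q j ≈ 0#
      qfact≉0 zero    = 1≉0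
      qfact≉0 (suc j) = x≉0∧y≉0⇒x*y≉0 (qfact≉0 j) (qint≉0 (suc j) (s≤s z≤n))

      coeff-closedForm⁺ : ∀ k m j → k ℕ.+ m ≡ suc j →
        coeff (k ℕ.* 2 ℕ.+ m) k * (qEvenFact k * qfact q m) ≈ pow q (k ℕ.* k) * qint q (k ℕ.* 2 ℕ.+ m) * qEvenFact j
      coeff-closedForm⁺ k m j k+m≡1+j = *-cancelʳ-≉0 (qint≉0 (suc j ℕ.+ suc j) (s≤s z≤n)) (begin
        coeff n k * (qEvenFact k * qfact q m) * W    ≈⟨ solve 4 (λ c E f W → c :* (E :* f) :* W := c :* E :* f :* W) refl _ _ _ W ⟩
        coeff n k * qEvenFact k * qfact q m * W      ≈⟨ closedForm ⟩
        pow q (k ℕ.* k) * qint q n * qEvenFact (suc j) ≈⟨ *-congˡ (qEvenFact-suc j) ⟩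
        pow q (k ℕ.* k) * qint q n * (qEvenFact j * W) ≈⟨ sym (*-assoc _ _ _) ⟩
        pow q (k ℕ.* k) * qint q n * qEvenFact j * W ∎)
        where
        n = k ℕ.* 2 ℕ.+ m
        W = qint q (suc j ℕ.+ suc j)
        closedForm : coeff n k * qEvenFact k * qfact q m * W ≈ pow q (k ℕ.* k) * qint q n * qEvenFact (suc j)
        closedForm = ≡.subst (λ i → coeff n k * qEvenFact k * qfact q m * qint q (i ℕ.+ i)
                                    ≈ pow q (k ℕ.* k) * qint q n * qEvenFact i)
                       k+m≡1+j (coeff-closedForm k m)

      module _ (1+q^i≉0 : ∀ i → 1 ≤ i → ¬ (1# + pow q i) ≈ 0#) where

        prodCount≉0 : ∀ a j → 1 ≤ a → ¬ prodCount q a j ≈ 0#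
        prodCount≉0 a zero    _   = 1≉0
        prodCount≉0 a (suc j) 1≤a = x≉0∧y≉0⇒x*y≉0 (1+q^i≉0 a 1≤a) (prodCount≉0 (suc a) j (ℕ.m≤n⇒m≤1+n 1≤a))

        qEvenFact≉0 : ∀ j → ¬ qEvenFact j ≈ 0#
        qEvenFact≉0 j = x≉0∧y≉0⇒x*y≉0 (prodCount≉0 1 j ℕ.≤-refl) (qfact≉0 j)

        ratio*prodCount : ∀ k a → ratio k (suc a) (a ℕ.+ k) * prodCount q 1 k ≈ prodCount q 1 a
        ratio*prodCount k a = begin
          prodCount q 1 (a ℕ.+ k) * (Ek * prodCount q (suc a) ((a ℕ.+ k) ℕ.∸ a)) ⁻¹ * Ek
            ≈⟨ reflexive (≡.cong (λ i → prodCount q 1 (a ℕ.+ k) * (Ek * prodCount q (suc a) i) ⁻¹ * Ek) (ℕ.m+n∸m≡n a k)) ⟩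
          prodCount q 1 (a ℕ.+ k) * (Ek * Y) ⁻¹ * Ek
            ≈⟨ *-congʳ (*-congʳ (prodCount-+ 1 a k)) ⟩
          prodCount q 1 a * Y * (Ek * Y) ⁻¹ * Ek
            ≈⟨ solve 4 (λ Ea Y Z Ek → Ea :* Y :* Z :* Ek := Ea :* ((Ek :* Y) :* Z)) refl (prodCount q 1 a) Y ((Ek * Y) ⁻¹) Ek ⟩
          prodCount q 1 a * ((Ek * Y) * (Ek * Y) ⁻¹)
            ≈⟨ *-congˡ (inverseʳ (Ek * Y) (x≉0∧y≉0⇒x*y≉0 (prodCount≉0 1 k ℕ.≤-refl)
                                                         (prodCount≉0 (suc a) k (s≤s z≤n)))) ⟩
          prodCount q 1 a * 1#
            ≈⟨ *-identityʳ _ ⟩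
          prodCount q 1 a ∎
          where
          Ek = prodCount q 1 k
          Y  = prodCount q (suc a) k

        ratio≈prodCount : ∀ k m → ratio k (suc (k ℕ.+ m)) ((k ℕ.+ m) ℕ.+ k) ≈ prodCount q (suc k) m
        ratio≈prodCount k m = *-cancelʳ-≉0 (prodCount≉0 1 k ℕ.≤-refl)
          (trans (ratio*prodCount k (k ℕ.+ m)) (trans (prodCount-+ 1 k m) (*-comm _ _)))

        coeff₁-closedForm : ∀ n k m j → k ℕ.+ m ≡ suc j →
          coeff₁ n k (suc j) (j ℕ.+ k) * (qEvenFact k * qfact q m) ≈ pow q (k ℕ.* k) * qint q n * qEvenFact j
        coeff₁-closedForm n k m j k+m≡1+j = begin
          Q * R * (N / S) * (qfact q (suc j) / (fk * qfact q (suc j ℕ.∸ k))) * (Ek * fk * fm)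
            ≈⟨ reflexive (≡.cong (λ i → Q * R * (N / S) * (qfact q (suc j) / (fk * qfact q i)) * (Ek * fk * fm)) 1+j∸k≡m) ⟩
          Q * R * (N * S ⁻¹) * (fj * S * (fk * fm) ⁻¹) * (Ek * fk * fm)
            ≈⟨ solve 10 (λ Q R N S′ fj S B′ Ek fk fm →
                 Q :* R :* (N :* S′) :* (fj :* S :* B′) :* (Ek :* fk :* fm)
                   := Q :* N :* (R :* Ek) :* fj :* (S :* S′) :* ((fk :* fm) :* B′))
                 refl Q R N (S ⁻¹) fj S ((fk * fm) ⁻¹) Ek fk fm ⟩
          Q * N * (R * Ek) * fj * (S * S ⁻¹) * ((fk * fm) * (fk * fm) ⁻¹)
            ≈⟨ *-cong (*-cong (*-congʳ (*-congˡ (ratio*prodCount k j))) (inverseʳ S (qint≉0 (suc j) (s≤s z≤n))))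
                      (inverseʳ (fk * fm) (x≉0∧y≉0⇒x*y≉0 (qfact≉0 k) (qfact≉0 m))) ⟩
          Q * N * prodCount q 1 j * fj * 1# * 1#
            ≈⟨ solve 4 (λ Q N Ej fj → Q :* N :* Ej :* fj :* con 1 :* con 1 := Q :* N :* (Ej :* fj)) refl Q N (prodCount q 1 j) fj ⟩
          Q * N * qEvenFact j ∎
          where
          Q  = pow q (k ℕ.* k)
          R  = ratio k (suc j) (j ℕ.+ k)
          N  = qint q n
          S  = qint q (suc j)
          Ek = prodCount q 1 k
          fj = qfact q j
          fk = qfact q k
          fm = qfact q m
          1+j∸k≡m : suc j ℕ.∸ k ≡ m
          1+j∸k≡m = ≡.trans (≡.cong (ℕ._∸ k) (≡.sym k+m≡1+j)) (ℕ.m+n∸m≡n k m)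

        coeff≈coeff₁ : ∀ n k m j → n ≡ k ℕ.* 2 ℕ.+ m → k ℕ.+ m ≡ suc j → coeff n k ≈ coeff₁ n k (suc j) (j ℕ.+ k)
        coeff≈coeff₁ n k m j ≡.refl k+m≡1+j = *-cancelʳ-≉0 (x≉0∧y≉0⇒x*y≉0 (qEvenFact≉0 k) (qfact≉0 m))
          (trans (coeff-closedForm⁺ k m j k+m≡1+j) (sym (coeff₁-closedForm n k m j k+m≡1+j)))

        monomial≈term₁ : ∀ x s n k → 1 ≤ n → 2 ℕ.* k ≤ n → monomial x s n k ≈ term₁ q n x s k
        monomial≈term₁ x s n k 1≤n 2k≤n =
          *-congʳ (*-congʳ (coeff≈ (1≤k+[k+m]⇒k+m≡suc k m (≡.subst (1 ≤_) n≡k+[k+m] 1≤n))))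
          where
          m = n ℕ.∸ 2 ℕ.* k
          n≡k+[k+m] : n ≡ k ℕ.+ (k ℕ.+ m)
          n≡k+[k+m] = 2*k≤n⇒n≡k+[k+[n∸2*k]] k 2k≤n
          coeff≈ : Σ ℕ (λ j → k ℕ.+ m ≡ suc j) → coeff n k ≈ coeff₁ n k (n ℕ.∸ k) (n ℕ.∸ 1)
          coeff≈ (j , k+m≡1+j) = trans (coeff≈coeff₁ n k m j n≡k*2+m k+m≡1+j)
                                       (reflexive (≡.cong₂ (coeff₁ n k) (≡.sym n∸k≡1+j) (≡.sym n∸1≡j+k)))
            where
            n≡k+1+j : n ≡ k ℕ.+ suc j
            n≡k+1+j = ≡.trans n≡k+[k+m] (≡.cong (k ℕ.+_) k+m≡1+j)
            n∸k≡1+j : n ℕ.∸ k ≡ suc j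
            n∸k≡1+j = ≡.trans (≡.cong (ℕ._∸ k) n≡k+1+j) (ℕ.m+n∸m≡n k (suc j))
            n∸1≡j+k : n ℕ.∸ 1 ≡ j ℕ.+ k
            n∸1≡j+k = ≡.trans (≡.cong (ℕ._∸ 1) (≡.trans n≡k+1+j (ℕ.+-suc k j))) (ℕ.+-comm k j)
            n≡k*2+m : n ≡ k ℕ.* 2 ℕ.+ m
            n≡k*2+m = ≡.trans n≡k+[k+m] (≡.trans (≡.sym (ℕ.+-assoc k k m)) (≡.cong (ℕ._+ m) (≡.sym (k*2≡k+k k))))

        term₁≈term₂ : ∀ x s n k → 2 ℕ.* k < n → term₁ q n x s k ≈ term₂ q n x s k
        term₁≈term₂ x s (suc n) k (s≤s 2k≤n) = *-congʳ (*-congʳ (*-congʳ (*-congʳ (*-congˡ (begin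
          ratio k (suc n ℕ.∸ k) n                      ≈⟨ reflexive (≡.cong₂ (ratio k) 1+n∸k≡1+k+m n≡k+m+k) ⟩
          ratio k (suc (k ℕ.+ m)) ((k ℕ.+ m) ℕ.+ k)    ≈⟨ ratio≈prodCount k m ⟩
          prodCount q (suc k) m                        ≈⟨ reflexive (≡.cong (prodCount q (suc k)) (≡.sym k+m∸k≡m)) ⟩
          prodOnePlus q (suc k) (suc n ℕ.∸ k ℕ.∸ 1)    ∎)))))
          where
          m = n ℕ.∸ 2 ℕ.* k
          n≡k+[k+m] : n ≡ k ℕ.+ (k ℕ.+ m)
          n≡k+[k+m] = 2*k≤n⇒n≡k+[k+[n∸2*k]] k 2k≤n
          n≡k+m+k : n ≡ (k ℕ.+ m) ℕ.+ k
          n≡k+m+k = ≡.trans n≡k+[k+m] (ℕ.+-comm k (k ℕ.+ m))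
          1+n∸k≡1+k+m : suc n ℕ.∸ k ≡ suc (k ℕ.+ m)
          1+n∸k≡1+k+m = ≡.trans (≡.cong (λ i → suc i ℕ.∸ k) n≡k+[k+m])
            (≡.trans (≡.cong (ℕ._∸ k) (≡.sym (ℕ.+-suc k (k ℕ.+ m)))) (ℕ.m+n∸m≡n k (suc (k ℕ.+ m))))
          k+m∸k≡m : suc n ℕ.∸ k ℕ.∸ 1 ℕ.∸ k ≡ m
          k+m∸k≡m = ≡.trans (≡.cong (λ i → i ℕ.∸ 1 ℕ.∸ k) 1+n∸k≡1+k+m) (ℕ.m+n∸m≡n k m)

        T≈sum₁ : ∀ x s n → 1 ≤ n → T q n x s ≈ sum₁ q n x s
        T≈sum₁ x s n 1≤n = trans (T≈sumTo-monomial x s n ⌊ n /2⌋ ℕ.≤-refl)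
          (sumTo-cong ⌊ n /2⌋ (λ k k≤⌊n/2⌋ → monomial≈term₁ x s n k 1≤n (k≤⌊n/2⌋⇒2*k≤n k≤⌊n/2⌋)))

        sumTo-term₁≈sumTo-term₂ : ∀ x s n → sumTo ⌊ n /2⌋ (term₁ q (suc n) x s) ≈ sumTo ⌊ n /2⌋ (term₂ q (suc n) x s)
        sumTo-term₁≈sumTo-term₂ x s n =
          sumTo-cong ⌊ n /2⌋ (λ k k≤⌊n/2⌋ → term₁≈term₂ x s (suc n) k (s≤s (k≤⌊n/2⌋⇒2*k≤n k≤⌊n/2⌋)))

        middle-term₁ : ∀ x s k → 1 ≤ k → term₁ q (k ℕ.+ k) x s k ≈ pow q (k ℕ.* k) * pow s k
        middle-term₁ x s k 1≤k = begin
          term₁ q n x s k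
            ≈⟨ sym (monomial≈term₁ x s n k (ℕ.≤-trans 1≤k (ℕ.m≤m+n k k)) (ℕ.≤-reflexive 2*k≡n)) ⟩
          coeff n k * pow s k * pow x (n ℕ.∸ 2 ℕ.* k)
            ≈⟨ reflexive (≡.cong₂ (λ a b → coeff a k * pow s k * pow x b)
                                  (≡.sym (k*2≡k+k k)) (ℕ.m≤n⇒m∸n≡0 (ℕ.≤-reflexive (≡.sym 2*k≡n)))) ⟩
          coeff (k ℕ.* 2) k * pow s k * 1#
            ≈⟨ trans (*-identityʳ _) (*-congʳ (coeff-diagonal k)) ⟩
          pow q (k ℕ.* k) * pow s k ∎
          where
          n = k ℕ.+ k
          2*k≡n : 2 ℕ.* k ≡ n
          2*k≡n = ≡.cong (k ℕ.+_) (ℕ.+-identityʳ k)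

        sum₁≈sum₂-odd : ∀ x s h → sum₁ q (suc (h ℕ.+ h)) x s ≈ sum₂ q (suc (h ℕ.+ h)) x s
        sum₁≈sum₂-odd x s h = begin
          sumTo ⌊ n /2⌋ (term₁ q n x s)             ≈⟨ reflexive (≡.cong (λ N → sumTo N (term₁ q n x s))
                                                                         ⌊n/2⌋≡⌊n∸1/2⌋) ⟩
          sumTo ⌊ h ℕ.+ h /2⌋ (term₁ q n x s)       ≈⟨ sumTo-term₁≈sumTo-term₂ x s (h ℕ.+ h) ⟩
          sumTo ⌊ h ℕ.+ h /2⌋ (term₂ q n x s)       ≈⟨ sym (+-identityʳ _) ⟩
          sumTo ⌊ h ℕ.+ h /2⌋ (term₂ q n x s) + 0#  ≈⟨ +-congˡ (sym (trans (*-congʳ (*-congʳ (iverson-no (n ℕ.% 2 ℕ.≟ 0) n%2≢0)))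
                                                         (solve 2 (λ a b → con 0 :* a :* b := con 0) refl _ _))) ⟩
          sum₂ q n x s                              ∎
          where
          n = suc (h ℕ.+ h)
          ⌊n/2⌋≡⌊n∸1/2⌋ : ⌊ n /2⌋ ≡ ⌊ h ℕ.+ h /2⌋
          ⌊n/2⌋≡⌊n∸1/2⌋ = ≡.trans (≡.sym (ℕ.n≡⌈n+n/2⌉ h)) (ℕ.n≡⌊n+n/2⌋ h)
          n%2≡1 : n ℕ.% 2 ≡ 1
          n%2≡1 = ≡.trans (≡.cong (λ i → suc i ℕ.% 2) (≡.sym (k*2≡k+k h))) (DivMod.[m+kn]%n≡m%n 1 h 2)
          n%2≢0 : ¬ n ℕ.% 2 ≡ 0
          n%2≢0 n%2≡0 = ℕ.1+n≢0 (≡.trans (≡.sym n%2≡1) n%2≡0)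

        sum₁≈sum₂-even : ∀ x s j → sum₁ q (suc j ℕ.+ suc j) x s ≈ sum₂ q (suc j ℕ.+ suc j) x s
        sum₁≈sum₂-even x s j = begin
          sumTo ⌊ n /2⌋ (term₁ q n x s)
            ≈⟨ reflexive (≡.cong (λ N → sumTo N (term₁ q n x s)) (≡.sym (ℕ.n≡⌊n+n/2⌋ (suc j)))) ⟩
          sumTo j (term₁ q n x s) + term₁ q n x s (suc j)
            ≈⟨ +-cong (trans (reflexive (≡.cong (λ N → sumTo N (term₁ q n x s)) j≡⌊n∸1/2⌋))
                             (sumTo-term₁≈sumTo-term₂ x s (j ℕ.+ suc j)))
                      (middle-term₁ x s (suc j) (s≤s z≤n)) ⟩
          sumTo ⌊ n ℕ.∸ 1 /2⌋ (term₂ q n x s) + pow q (suc j ℕ.* suc j) * pow s (suc j)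
            ≈⟨ +-congˡ (sym (*-congʳ (*-identityˡ _))) ⟩
          sumTo ⌊ n ℕ.∸ 1 /2⌋ (term₂ q n x s) + 1# * pow q (suc j ℕ.* suc j) * pow s (suc j)
            ≈⟨ +-congˡ (reflexive (≡.cong (λ h → 1# * pow q (h ℕ.* h) * pow s h) (ℕ.n≡⌊n+n/2⌋ (suc j)))) ⟩
          sumTo ⌊ n ℕ.∸ 1 /2⌋ (term₂ q n x s) + 1# * pow q (⌊ n /2⌋ ℕ.* ⌊ n /2⌋) * pow s ⌊ n /2⌋
            ≈⟨ +-congˡ (*-congʳ (*-congʳ (sym (iverson-yes (n ℕ.% 2 ℕ.≟ 0) n%2≡0)))) ⟩
          sum₂ q n x s ∎
          where
          n = suc j ℕ.+ suc j
          j≡⌊n∸1/2⌋ : j ≡ ⌊ j ℕ.+ suc j /2⌋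
          j≡⌊n∸1/2⌋ = ≡.trans (ℕ.n≡⌈n+n/2⌉ j) (≡.cong ⌊_/2⌋ (≡.sym (ℕ.+-suc j j)))
          n%2≡0 : n ℕ.% 2 ≡ 0
          n%2≡0 = ≡.trans (≡.cong (ℕ._% 2) (≡.sym (k*2≡k+k (suc j)))) (DivMod.m*n%n≡0 (suc j) 2)

        sum₁≈sum₂ : ∀ x s n → 1 ≤ n → sum₁ q n x s ≈ sum₂ q n x s
        sum₁≈sum₂ x s n 1≤n with evenOdd n | 1≤n
        ... | even zero    | ()
        ... | even (suc j) | _ = sum₁≈sum₂-even x s j
        ... | odd h        | _ = sum₁≈sum₂-odd x s h

theorem2p5 : ∀ {c ℓ : Level} (F : Field c ℓ) → let open Field F in let open QDefs F in
    (q : Carrier) →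
    (∀ (m : ℕ) → 1 ≤ m → ¬ (qint q m ≈ 0#)) →
    (∀ (i : ℕ) → 1 ≤ i → ¬ ((1# + pow q i) ≈ 0#)) →
    ∀ (x s : Carrier) (n : ℕ) → 1 ≤ n →
    (T q n x s ≈ sum₁ q n x s) × (sum₁ q n x s ≈ sum₂ q n x s)
theorem2p5 F q qint≉0 1+q^i≉0 x s n 1≤n =
  T≈sum₁ F q qint≉0 1+q^i≉0 x s n 1≤n , sum₁≈sum₂ F q qint≉0 1+q^i≉0 x s n 1≤n
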